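{- Let $G=(V,E)$ be a finite connected graph (parallel edges allowed, no loops) with Laplacian matrix $L$, resistance matrix $R$ and curvature vector $\boldsymbol\mu$. For a vertex $q\in V$ let $\gamma_q(G)=\frac14\sum_{e\in E}\bigl(r(e^+,q)-r(e^-,q)\bigr)^2$. Then for every $q\in V$: (a) every diagonal entry of $\frac14 RLR$ equals $\gamma_q(G)$; (b) $\gamma_q(G)=\frac12\boldsymbol\mu^{\intercal}R\boldsymbol\mu$; (c) every entry of the vector $\frac12 R\boldsymbol\mu$ equals $\gamma_q(G)$.
   Context: Each edge $e$ has endpoints $e^+,e^-$ (via an arbitrary orientation). The Laplacian $L\in\mathbb R^{V\times V}$ has $L_{v,v}=\deg v$ and $L_{v,w}=-$(number of edges between $v$ and $w$) for $v\neq w$. $r(v,w)$ is the effective resistance with a unit resistor on each edge (equivalently $(\mathbf e_v-\mathbf e_w)^{\intercal}L^{+}(\mathbf e_v-\mathbf e_w)$), and $R_{v,w}=r(v,w)$. The curvature vector is $\boldsymbol\mu_x = 1-\frac12\sum_{e\in\mathcal N_E(x)} r(e^+,e^-)$, where $\mathcal N_E(x)$ is the set of edges incident to $x$. -}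

module Defs where

open import Data.Nat using (ℕ; zero; suc)
open import Data.Fin using (Fin; zero; suc)
open import Data.Fin.Properties using (_≟_)
open import Data.Integer using (+_)
open import Data.Rational using (ℚ; 0ℚ; 1ℚ; ½; _+_; _*_; _-_; _/_)
open import Data.Bool using (Bool; true; false; _∨_; _∧_; if_then_else_)
open import Relation.Nullary.Decidable using (⌊_⌋)
open import Relation.Binary.PropositionalEquality using (_≡_)
open import Relation.Nullary using (¬_)

Σ : (n : ℕ) → (Fin n → ℚ) → ℚ
Σ zero    f = 0ℚ
Σ (suc n) f = f zero + Σ n (λ i → f (suc i))

Matrix : ℕ → Set
Matrix n = Fin n → Fin n → ℚ

Vector : ℕ → Set
Vector n = Fin n → ℚ

_⊗_ : ∀ {n} → Matrix n → Matrix n → Matrix n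
(A ⊗ B) i j = Σ _ (λ k → A i k * B k j)

infixl 7 _⊗_

transpose : ∀ {n} → Matrix n → Matrix n
transpose A i j = A j i

_·ᵥ_ : ∀ {n} → Matrix n → Vector n → Vector n
(A ·ᵥ x) i = Σ _ (λ k → A i k * x k)

dot : ∀ {n} → Vector n → Vector n → ℚ
dot x y = Σ _ (λ k → x k * y k)

-- Multigraph on vertex set Fin n with m edges; edge e goes src e → tgt e
-- (arbitrary orientation e⁺ = src e, e⁻ = tgt e).
record Graph (n m : ℕ) : Set where
  field
    src : Fin m → Fin n
    tgt : Fin m → Fin n
open Graph public

Loopless : ∀ {n m} → Graph n m → Set
Loopless G = ∀ e → ¬ (src G e ≡ tgt G e)

data Reach {n m} (G : Graph n m) : Fin n → Fin n → Set where
  here : ∀ {v} → Reach G v v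
  fwd  : ∀ {v} e → Reach G (tgt G e) v → Reach G (src G e) v
  bwd  : ∀ {v} e → Reach G (src G e) v → Reach G (tgt G e) v

Connected : ∀ {n m} → Graph n m → Set
Connected G = ∀ v w → Reach G v w

χ : Bool → ℚ
χ b = if b then 1ℚ else 0ℚ

eqᵇ : ∀ {n} → Fin n → Fin n → Bool
eqᵇ a b = ⌊ a ≟ b ⌋

incident : ∀ {n m} → Graph n m → Fin m → Fin n → Bool
incident G e x = eqᵇ (src G e) x ∨ eqᵇ (tgt G e) x

joins : ∀ {n m} → Graph n m → Fin m → Fin n → Fin n → Bool
joins G e v w = (eqᵇ (src G e) v ∧ eqᵇ (tgt G e) w) ∨ (eqᵇ (src G e) w ∧ eqᵇ (tgt G e) v)

degree : ∀ {n m} → Graph n m → Fin n → ℚ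
degree {m = m} G v = Σ m (λ e → χ (incident G e v))

laplacian : ∀ {n m} → Graph n m → Matrix n
laplacian {m = m} G v w =
  if eqᵇ v w then degree G v else (0ℚ - Σ m (λ e → χ (joins G e v w)))

IsPseudoInverse : ∀ {n} → Matrix n → Matrix n → Set
IsPseudoInverse A P =
  (∀ i j → (A ⊗ P ⊗ A) i j ≡ A i j) ×' ((∀ i j → (P ⊗ A ⊗ P) i j ≡ P i j) ×'
  ((∀ i j → transpose (A ⊗ P) i j ≡ (A ⊗ P) i j) ×'
   (∀ i j → transpose (P ⊗ A) i j ≡ (P ⊗ A) i j)))
  where
  open import Data.Product using () renaming (_×_ to _×'_)

basis : ∀ {n} → Fin n → Vector n
basis v i = χ (eqᵇ v i)

resistance : ∀ {n} → Matrix n → Fin n → Fin n → ℚ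
resistance P v w = dot d (P ·ᵥ d)
  where d = λ i → basis v i - basis w i

curvature : ∀ {n m} → Graph n m → Matrix n → Vector n
curvature {m = m} G P x =
  1ℚ - ½ * Σ m (λ e → χ (incident G e x) * resistance P (src G e) (tgt G e))

γ : ∀ {n m} → Graph n m → Matrix n → Fin n → ℚ
γ {m = m} G P q = (+ 1 / 4) * Σ m (λ e →
  (resistance P (src G e) q - resistance P (tgt G e) q) *
  (resistance P (src G e) q - resistance P (tgt G e) q))

-- Let c = 1/|V| and J the all-ones matrix. Connectivity makes the constant vectors the whole
-- kernel of L; together with the Penrose equations this forces P L = L P = I - cJ, so P is
-- symmetric with zero row sums and, writing d for the diagonal of P,  R = d 1ᵀ + 1 dᵀ - 2P.
-- Multiplying out gives R L = 1 (L d)ᵀ - 2I + 2cJ, whence every diagonal entry of R L R is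
-- dᵀ L d + 4c tr P = 4γ₀.  Summing the resistances of the edges at x through the incidence
-- vectors turns the curvature into μ = ½ L d + c 1, for which R μ = 2γ₀ 1 and 1ᵀ μ = 1.
-- Finally γ_q is the Laplacian quadratic form of the q-th column of R, i.e. ¼ (R L R)_qq = γ₀.

module Submission where

open import Defs
open import Data.Nat using (ℕ; zero; suc)
open import Data.Fin using (Fin; zero; suc)
open import Data.Fin.Properties using (_≟_)
open import Data.Integer using (+_)
open import Data.Rational using (ℚ; ½; _*_; _/_; _+_; _-_; 0ℚ; 1ℚ; _≤_; _<_; positive; negative)
open import Data.Rational.Properties
  using (+-*-commutativeRing; +-0-group; +-identityˡ; +-identityʳ; *-identityˡ; *-identityʳ;
         *-zeroˡ; *-zeroʳ; *-comm; *-assoc; +-inverseʳ; <-cmp; ≤-refl; <⇒≤; <-irrefl; ≤-antisym;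
         ≤-trans; +-mono-≤; +-monoʳ-≤; ≤-reflexive; positive⁻¹; pos*pos⇒pos; neg*neg⇒pos)
open import Data.Rational.Solver using (module +-*-Solver)
open import Algebra.Bundles using (CommutativeRing)
open import Algebra.Properties.Semiring.Sum (CommutativeRing.semiring +-*-commutativeRing)
  using (sum; sum-cong-≗; ∑-distrib-+; ∑-comm; *-distribˡ-sum; *-distribʳ-sum)
open import Algebra.Properties.Group +-0-group using (x∙y⁻¹≈ε⇒x≈y)
open import Data.Bool using (true; false; _∧_; _∨_)
open import Data.Bool.Properties using (T-≡)
open import Data.Product using (Σ-syntax; _×_; _,_; proj₁; proj₂)
open import Data.Sum using (_⊎_; inj₁; inj₂)
open import Data.Empty using (⊥-elim)
open import Function.Bundles using (mk⇔; Equivalence)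
open import Relation.Binary.Definitions using (tri<; tri≈; tri>)
open import Relation.Binary.PropositionalEquality using (_≡_; refl; sym; trans; cong; cong₂; module ≡-Reasoning)
open import Relation.Nullary using (¬_; yes; no; does)
open import Relation.Nullary.Decidable using (toWitness; isYes≗does; dec-true; dec-false; does-⇔; ⌊⌋-map′)
open ≡-Reasoning
open +-*-Solver

*-inverse-unique : ∀ N {a b} → N * a ≡ 1ℚ → N * b ≡ 1ℚ → a ≡ b
*-inverse-unique N {a} {b} Na≡1 Nb≡1 = begin
  a            ≡⟨ sym (*-identityʳ a) ⟩
  a * 1ℚ       ≡⟨ cong (a *_) (sym Nb≡1) ⟩
  a * (N * b)  ≡⟨ solve 3 (λ a b N → a :* (N :* b) := b :* (N :* a)) refl a b N ⟩
  b * (N * a)  ≡⟨ cong (b *_) Na≡1 ⟩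
  b * 1ℚ       ≡⟨ *-identityʳ b ⟩
  b            ∎

*-cancel-invertible : ∀ N c a → N * c ≡ 1ℚ → N * a ≡ 0ℚ → a ≡ 0ℚ
*-cancel-invertible N c a Nc≡1 Na≡0 = begin
  a             ≡⟨ sym (*-identityˡ a) ⟩
  1ℚ * a        ≡⟨ cong (_* a) (sym Nc≡1) ⟩
  N * c * a     ≡⟨ solve 3 (λ N c a → N :* c :* a := c :* (N :* a)) refl N c a ⟩
  c * (N * a)   ≡⟨ cong (c *_) Na≡0 ⟩
  c * 0ℚ        ≡⟨ *-zeroʳ c ⟩
  0ℚ            ∎

½-double : ∀ x → ½ * (x + x) ≡ x
½-double = solve 1 (λ x → con ½ :* (x :+ x) := x) refl

¼-quadruple : ∀ x → (+ 1 / 4) * ((x + x) + (x + x)) ≡ x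
¼-quadruple = solve 1 (λ x → con (+ 1 / 4) :* ((x :+ x) :+ (x :+ x)) := x) refl

square-zero-or-pos : ∀ y → y ≡ 0ℚ ⊎ 0ℚ < y * y
square-zero-or-pos y with <-cmp y 0ℚ
... | tri< y<0 _ _ = inj₂ (positive⁻¹ (y * y) {{neg*neg⇒pos y {{negative y<0}} y {{negative y<0}}}})
... | tri≈ _ y≡0 _ = inj₁ y≡0
... | tri> _ _ y>0 = inj₂ (positive⁻¹ (y * y) {{pos*pos⇒pos y {{positive y>0}} y {{positive y>0}}}})

square-nonNeg : ∀ y → 0ℚ ≤ y * y
square-nonNeg y with square-zero-or-pos y
... | inj₁ refl = ≤-refl
... | inj₂ 0<y² = <⇒≤ 0<y²

square≡0⇒≡0 : ∀ y → y * y ≡ 0ℚ → y ≡ 0ℚ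
square≡0⇒≡0 y y²≡0 with square-zero-or-pos y
... | inj₁ y≡0 = y≡0
... | inj₂ 0<y² = ⊥-elim (<-irrefl (sym y²≡0) 0<y²)

+-nonNeg≡0⇒≡0 : ∀ {a b} → 0ℚ ≤ a → 0ℚ ≤ b → a + b ≡ 0ℚ → a ≡ 0ℚ × b ≡ 0ℚ
+-nonNeg≡0⇒≡0 {a} {b} 0≤a 0≤b a+b≡0 = a≡0 , b≡0
  where
  a≡0 : a ≡ 0ℚ
  a≡0 = ≤-antisym (≤-trans (≤-reflexive (sym (+-identityʳ a))) (≤-trans (+-monoʳ-≤ a 0≤b) (≤-reflexive a+b≡0))) 0≤a
  b≡0 : b ≡ 0ℚ
  b≡0 = trans (sym (+-identityˡ b)) (trans (cong (_+ b) (sym a≡0)) a+b≡0)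

Σ≡sum : ∀ n (f : Fin n → ℚ) → Σ n f ≡ sum f
Σ≡sum zero    f = refl
Σ≡sum (suc n) f = cong (_+_ (f zero)) (Σ≡sum n (λ i → f (suc i)))

Σ-cong : ∀ n {f g : Fin n → ℚ} → (∀ i → f i ≡ g i) → Σ n f ≡ Σ n g
Σ-cong n eq = trans (Σ≡sum n _) (trans (sum-cong-≗ eq) (sym (Σ≡sum n _)))

Σ-distrib-+ : ∀ n (f g : Fin n → ℚ) → Σ n (λ i → f i + g i) ≡ Σ n f + Σ n g
Σ-distrib-+ n f g = begin
  Σ n (λ i → f i + g i) ≡⟨ Σ≡sum n _ ⟩
  sum (λ i → f i + g i) ≡⟨ ∑-distrib-+ f g ⟩
  sum f + sum g         ≡⟨ sym (cong₂ _+_ (Σ≡sum n f) (Σ≡sum n g)) ⟩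
  Σ n f + Σ n g         ∎

Σ-distrib-minus : ∀ n (f g : Fin n → ℚ) → Σ n (λ i → f i - g i) ≡ Σ n f - Σ n g
Σ-distrib-minus n f g = begin
  Σ n h                     ≡⟨ solve 2 (λ a b → a := (a :+ b) :- b) refl (Σ n h) (Σ n g) ⟩
  (Σ n h + Σ n g) - Σ n g   ≡⟨ cong (_- Σ n g) (sym (Σ-distrib-+ n h g)) ⟩
  Σ n (λ i → h i + g i) - Σ n g
    ≡⟨ cong (_- Σ n g) (Σ-cong n (λ i → solve 2 (λ a b → (a :- b) :+ b := a) refl (f i) (g i))) ⟩
  Σ n f - Σ n g             ∎
  where
  h : Fin n → ℚ
  h i = f i - g i

*-distribˡ-Σ : ∀ n a (f : Fin n → ℚ) → a * Σ n f ≡ Σ n (λ i → a * f i)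
*-distribˡ-Σ n a f = trans (cong (a *_) (Σ≡sum n f)) (trans (*-distribˡ-sum a f) (sym (Σ≡sum n _)))

*-distribʳ-Σ : ∀ n a (f : Fin n → ℚ) → Σ n f * a ≡ Σ n (λ i → f i * a)
*-distribʳ-Σ n a f = trans (cong (_* a) (Σ≡sum n f)) (trans (*-distribʳ-sum a f) (sym (Σ≡sum n _)))

Σ-linear : ∀ n a b (f g : Fin n → ℚ) → Σ n (λ i → a * f i + b * g i) ≡ a * Σ n f + b * Σ n g
Σ-linear n a b f g = trans (Σ-distrib-+ n _ _) (sym (cong₂ _+_ (*-distribˡ-Σ n a f) (*-distribˡ-Σ n b g)))

Σ-comm : ∀ n m (f : Fin n → Fin m → ℚ) →
         Σ n (λ i → Σ m (f i)) ≡ Σ m (λ j → Σ n (λ i → f i j))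
Σ-comm n m f = begin
  Σ n (λ i → Σ m (f i))              ≡⟨ Σ-cong n (λ i → Σ≡sum m (f i)) ⟩
  Σ n (λ i → sum (f i))              ≡⟨ Σ≡sum n _ ⟩
  sum (λ i → sum (f i))              ≡⟨ ∑-comm f ⟩
  sum (λ j → sum (λ i → f i j))      ≡⟨ sym (Σ≡sum m _) ⟩
  Σ m (λ j → sum (λ i → f i j))      ≡⟨ Σ-cong m (λ j → sym (Σ≡sum n (λ i → f i j))) ⟩
  Σ m (λ j → Σ n (λ i → f i j))      ∎

Σ-zero : ∀ n {f : Fin n → ℚ} → (∀ i → f i ≡ 0ℚ) → Σ n f ≡ 0ℚ
Σ-zero zero    eq = refl
Σ-zero (suc n) eq = trans (cong₂ _+_ (eq zero) (Σ-zero n (λ i → eq (suc i)))) (+-identityˡ 0ℚ)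

Σ-const : ∀ n a → Σ n (λ _ → a) ≡ Σ n (λ _ → 1ℚ) * a
Σ-const n a = trans (Σ-cong n (λ _ → sym (*-identityˡ a))) (sym (*-distribʳ-Σ n a (λ _ → 1ℚ)))

Σ-squares-nonNeg : ∀ m (y : Fin m → ℚ) → 0ℚ ≤ Σ m (λ e → y e * y e)
Σ-squares-nonNeg zero    y = ≤-refl
Σ-squares-nonNeg (suc m) y = +-mono-≤ (square-nonNeg (y zero)) (Σ-squares-nonNeg m (λ e → y (suc e)))

Σ-squares≡0⇒≡0 : ∀ m (y : Fin m → ℚ) → Σ m (λ e → y e * y e) ≡ 0ℚ → ∀ e → y e ≡ 0ℚ
Σ-squares≡0⇒≡0 (suc m) y eq e
  with +-nonNeg≡0⇒≡0 (square-nonNeg (y zero)) (Σ-squares-nonNeg m (λ e → y (suc e))) eq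
Σ-squares≡0⇒≡0 (suc m) y eq zero    | y₀²≡0 , _    = square≡0⇒≡0 (y zero) y₀²≡0
Σ-squares≡0⇒≡0 (suc m) y eq (suc e) | _    , rest≡0 = Σ-squares≡0⇒≡0 m (λ e → y (suc e)) rest≡0 e

eqᵇ-refl : ∀ {n} (v : Fin n) → eqᵇ v v ≡ true
eqᵇ-refl v = trans (isYes≗does (v ≟ v)) (dec-true (v ≟ v) refl)

eqᵇ-≢ : ∀ {n} {v w : Fin n} → ¬ v ≡ w → eqᵇ v w ≡ false
eqᵇ-≢ {v = v} {w} v≢w = trans (isYes≗does (v ≟ w)) (dec-false (v ≟ w) v≢w)

eqᵇ⇒≡ : ∀ {n} {v w : Fin n} → eqᵇ v w ≡ true → v ≡ w
eqᵇ⇒≡ eq = toWitness (Equivalence.from T-≡ eq)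

eqᵇ-sym : ∀ {n} (v w : Fin n) → eqᵇ v w ≡ eqᵇ w v
eqᵇ-sym v w = begin
  eqᵇ v w            ≡⟨ isYes≗does (v ≟ w) ⟩
  does (v ≟ w)       ≡⟨ does-⇔ (mk⇔ sym sym) (v ≟ w) (w ≟ v) ⟩
  does (w ≟ v)       ≡⟨ sym (isYes≗does (w ≟ v)) ⟩
  eqᵇ w v            ∎

eqᵇ-disjoint : ∀ {n} {a b : Fin n} x → ¬ a ≡ b → eqᵇ a x ∧ eqᵇ b x ≡ false
eqᵇ-disjoint {a = a} x a≢b with eqᵇ a x in ax
... | false = refl
... | true  = eqᵇ-≢ (λ b≡x → a≢b (trans (eqᵇ⇒≡ ax) (sym b≡x)))

basis-sym : ∀ {n} (v w : Fin n) → basis v w ≡ basis w v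
basis-sym v w = cong χ (eqᵇ-sym v w)

Σ-basis : ∀ n (v : Fin n) (f : Fin n → ℚ) → Σ n (λ k → basis v k * f k) ≡ f v
Σ-basis (suc n) zero f = begin
  1ℚ * f zero + Σ n (λ k → 0ℚ * f (suc k))
    ≡⟨ cong₂ _+_ (*-identityˡ (f zero)) (Σ-zero n (λ k → *-zeroˡ (f (suc k)))) ⟩
  f zero + 0ℚ ≡⟨ +-identityʳ (f zero) ⟩
  f zero      ∎
Σ-basis (suc n) (suc v) f = begin
  0ℚ * f zero + Σ n (λ k → basis (suc v) (suc k) * f (suc k))
    ≡⟨ cong₂ _+_ (*-zeroˡ (f zero))
         (Σ-cong n (λ k → cong (λ b → χ b * f (suc k)) (⌊⌋-map′ _ _ (v ≟ k)))) ⟩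
  0ℚ + Σ n (λ k → basis v k * f (suc k)) ≡⟨ +-identityˡ _ ⟩
  Σ n (λ k → basis v k * f (suc k))      ≡⟨ Σ-basis n v (λ k → f (suc k)) ⟩
  f (suc v)                              ∎

Σ-basis-one : ∀ n (v : Fin n) → Σ n (basis v) ≡ 1ℚ
Σ-basis-one n v = trans (Σ-cong n (λ k → sym (*-identityʳ (basis v k)))) (Σ-basis n v (λ _ → 1ℚ))

Σ-basis-diff : ∀ n (v w : Fin n) (f : Fin n → ℚ) →
               Σ n (λ k → (basis v k - basis w k) * f k) ≡ f v - f w
Σ-basis-diff n v w f = begin
  Σ n (λ k → (basis v k - basis w k) * f k)
    ≡⟨ Σ-cong n (λ k → solve 3 (λ a b x → (a :- b) :* x := a :* x :- b :* x) refl (basis v k) (basis w k) (f k)) ⟩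
  Σ n (λ k → basis v k * f k - basis w k * f k)
    ≡⟨ Σ-distrib-minus n _ _ ⟩
  Σ n (λ k → basis v k * f k) - Σ n (λ k → basis w k * f k)
    ≡⟨ cong₂ _-_ (Σ-basis n v f) (Σ-basis n w f) ⟩
  f v - f w ∎

IsSymmetric : ∀ {n} → Matrix n → Set
IsSymmetric A = ∀ i j → A i j ≡ A j i

⊗-assoc : ∀ {n} (A B C : Matrix n) i j → (A ⊗ B ⊗ C) i j ≡ (A ⊗ (B ⊗ C)) i j
⊗-assoc {n} A B C i j = begin
  Σ n (λ k → Σ n (λ l → A i l * B l k) * C k j)
    ≡⟨ Σ-cong n (λ k → *-distribʳ-Σ n (C k j) _) ⟩
  Σ n (λ k → Σ n (λ l → A i l * B l k * C k j))
    ≡⟨ Σ-comm n n _ ⟩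
  Σ n (λ l → Σ n (λ k → A i l * B l k * C k j))
    ≡⟨ Σ-cong n (λ l → trans (Σ-cong n (λ k → *-assoc (A i l) _ _)) (sym (*-distribˡ-Σ n (A i l) _))) ⟩
  Σ n (λ l → A i l * Σ n (λ k → B l k * C k j)) ∎

⊗-identityʳ : ∀ {n} (A : Matrix n) i j → (A ⊗ basis) i j ≡ A i j
⊗-identityʳ {n} A i j =
  trans (Σ-cong n (λ k → trans (*-comm (A i k) _) (cong (_* A i k) (basis-sym k j)))) (Σ-basis n j (A i))

⊗-transpose : ∀ {n} {A B : Matrix n} → IsSymmetric A → IsSymmetric B →
              ∀ i j → (A ⊗ B) i j ≡ (B ⊗ A) j i
⊗-transpose {n} {A} {B} A-sym B-sym i j =
  Σ-cong n (λ k → trans (*-comm (A i k) (B k j)) (cong₂ _*_ (B-sym k j) (A-sym i k)))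

Σ-row-⊗ : ∀ {n} (A B : Matrix n) i → Σ n ((A ⊗ B) i) ≡ Σ n (λ k → A i k * Σ n (B k))
Σ-row-⊗ {n} A B i = trans (Σ-comm n n _) (Σ-cong n (λ k → sym (*-distribˡ-Σ n (A i k) (B k))))

Σ-col-⊗ : ∀ {n} (A B : Matrix n) j → Σ n (λ i → (A ⊗ B) i j) ≡ Σ n (λ k → Σ n (λ i → A i k) * B k j)
Σ-col-⊗ {n} A B j = trans (Σ-comm n n _) (Σ-cong n (λ k → sym (*-distribʳ-Σ n (B k j) (λ i → A i k))))

·ᵥ-⊗ : ∀ {n} (A B : Matrix n) (x : Vector n) i → (A ·ᵥ (B ·ᵥ x)) i ≡ ((A ⊗ B) ·ᵥ x) i
·ᵥ-⊗ A B x i = sym (⊗-assoc A B (λ k _ → x k) i i)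

dot-column : ∀ {n} {A : Matrix n} → IsSymmetric A → ∀ (L : Matrix n) q →
             dot (λ i → A i q) (L ·ᵥ (λ i → A i q)) ≡ (A ⊗ L ⊗ A) q q
dot-column {n} {A} A-sym L q =
  trans (Σ-cong n (λ j → cong (_* (L ⊗ A) j q) (A-sym j q))) (sym (⊗-assoc A L A q q))

resistance-expand : ∀ {n} (P : Matrix n) v w →
  resistance P v w ≡ (P v v + P w w) - (P v w + P w v)
resistance-expand {n} P v w = begin
  Σ n (λ k → (basis v k - basis w k) * Σ n (λ l → P k l * (basis v l - basis w l)))
    ≡⟨ Σ-cong n (λ k → cong ((basis v k - basis w k) *_)
         (trans (Σ-cong n (λ l → *-comm (P k l) _)) (Σ-basis-diff n v w (P k)))) ⟩
  Σ n (λ k → (basis v k - basis w k) * (P k v - P k w))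
    ≡⟨ Σ-basis-diff n v w (λ k → P k v - P k w) ⟩
  (P v v - P v w) - (P w v - P w w)
    ≡⟨ solve 4 (λ a b c d → (a :- b) :- (c :- d) := (a :+ d) :- (b :+ c)) refl (P v v) (P v w) (P w v) (P w w) ⟩
  (P v v + P w w) - (P v w + P w v) ∎

resistance-sym : ∀ {n} (P : Matrix n) → IsSymmetric (resistance P)
resistance-sym P v w = begin
  resistance P v w                   ≡⟨ resistance-expand P v w ⟩
  (P v v + P w w) - (P v w + P w v)
    ≡⟨ solve 4 (λ a b c d → (a :+ b) :- (c :+ d) := (b :+ a) :- (d :+ c)) refl (P v v) (P w w) (P v w) (P w v) ⟩
  (P w w + P v v) - (P w v + P v w)  ≡⟨ sym (resistance-expand P w v) ⟩
  resistance P w v                   ∎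

resistance-diag : ∀ {n} (P : Matrix n) v → resistance P v v ≡ 0ℚ
resistance-diag P v = trans (resistance-expand P v v) (+-inverseʳ (P v v + P v v))

-- Pseudo-inverse of a Laplacian whose kernel is spanned by the constant vector

record IsConnectedLaplacian {n} (L : Matrix n) : Set where
  field
    symmetric       : IsSymmetric L
    rowSum≡0        : ∀ i → Σ n (L i) ≡ 0ℚ
    kernel-constant : ∀ x → (∀ i → (L ·ᵥ x) i ≡ 0ℚ) → ∀ i j → x i ≡ x j

module ConnectedLaplacian {n} {L : Matrix n} (isL : IsConnectedLaplacian L)
                          {P : Matrix n} (pinv : IsPseudoInverse L P) (o : Fin n) where
  -- The vertex o only witnesses n > 0; the constant c = 1/N defined below does not depend on it.
  open IsConnectedLaplacian isL

  N : ℚ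
  N = Σ n (λ _ → 1ℚ)

  colSum≡0 : ∀ j → Σ n (λ i → L i j) ≡ 0ℚ
  colSum≡0 j = trans (Σ-cong n (λ i → symmetric i j)) (rowSum≡0 j)

  LPL≡L : ∀ i j → (L ⊗ P ⊗ L) i j ≡ L i j
  LPL≡L = proj₁ pinv

  PLP≡P : ∀ i j → (P ⊗ L ⊗ P) i j ≡ P i j
  PLP≡P = proj₁ (proj₂ pinv)

  LP-sym : IsSymmetric (L ⊗ P)
  LP-sym i j = sym (proj₁ (proj₂ (proj₂ pinv)) i j)

  PL-sym : IsSymmetric (P ⊗ L)
  PL-sym i j = sym (proj₂ (proj₂ (proj₂ pinv)) i j)

  kernel-sum≡0 : ∀ x → (∀ i → (L ·ᵥ x) i ≡ 0ℚ) → ∀ c → N * c ≡ 1ℚ → Σ n x ≡ 0ℚ → ∀ i → x i ≡ 0ℚ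
  kernel-sum≡0 x Lx≡0 c Nc≡1 Σx≡0 i = *-cancel-invertible N c (x i) Nc≡1 (begin
    N * x i             ≡⟨ sym (Σ-const n (x i)) ⟩
    Σ n (λ _ → x i)     ≡⟨ Σ-cong n (kernel-constant x Lx≡0 i) ⟩
    Σ n x               ≡⟨ Σx≡0 ⟩
    0ℚ                  ∎)

  kernel-symmetric-constant : ∀ {X : Matrix n} → IsSymmetric X →
                              (∀ i j → (L ⊗ X) i j ≡ 0ℚ) → ∀ i j → X i j ≡ X o o
  kernel-symmetric-constant {X} X-sym LX≡0 i j = begin
    X i j  ≡⟨ column j i o ⟩
    X o j  ≡⟨ X-sym o j ⟩
    X j o  ≡⟨ column o j o ⟩
    X o o  ∎
    where
    column : ∀ j i k → X i j ≡ X k j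
    column j = kernel-constant (λ k → X k j) (λ i → LX≡0 i j)

  Σ-centering : ∀ c i → Σ n (λ j → basis i j - c) ≡ 1ℚ - N * c
  Σ-centering c i = trans (Σ-distrib-minus n (basis i) (λ _ → c)) (cong₂ _-_ (Σ-basis-one n i) (Σ-const n c))

  centering : ∀ {M : Matrix n} → IsSymmetric M → (∀ i j → (L ⊗ M) i j ≡ L i j) →
              (∀ i → Σ n (M i) ≡ 0ℚ) → Σ[ c ∈ ℚ ] N * c ≡ 1ℚ × (∀ i j → M i j ≡ basis i j - c)
  centering {M} M-sym LM≡L M-row = c , Nc≡1 , M≡
    where
    X : Matrix n
    X i j = basis i j - M i j

    LX≡0 : ∀ i j → (L ⊗ X) i j ≡ 0ℚ
    LX≡0 i j = begin
      Σ n (λ k → L i k * (basis k j - M k j))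
        ≡⟨ Σ-cong n (λ k → solve 3 (λ l b m → l :* (b :- m) := l :* b :- l :* m) refl (L i k) (basis k j) (M k j)) ⟩
      Σ n (λ k → L i k * basis k j - L i k * M k j) ≡⟨ Σ-distrib-minus n _ _ ⟩
      (L ⊗ basis) i j - (L ⊗ M) i j                  ≡⟨ cong₂ _-_ (⊗-identityʳ L i j) (LM≡L i j) ⟩
      L i j - L i j                                  ≡⟨ +-inverseʳ (L i j) ⟩
      0ℚ                                             ∎

    c : ℚ
    c = X o o

    M≡ : ∀ i j → M i j ≡ basis i j - c
    M≡ i j = begin
      M i j                        ≡⟨ solve 2 (λ b m → m := b :- (b :- m)) refl (basis i j) (M i j) ⟩
      basis i j - X i j            ≡⟨ cong (basis i j -_) (kernel-symmetric-constant X-sym LX≡0 i j) ⟩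
      basis i j - c                ∎
      where
      X-sym : IsSymmetric X
      X-sym i j = cong₂ _-_ (basis-sym i j) (M-sym i j)

    Nc≡1 : N * c ≡ 1ℚ
    Nc≡1 = sym (x∙y⁻¹≈ε⇒x≈y 1ℚ (N * c) (begin
      1ℚ - N * c                  ≡⟨ sym (Σ-centering c o) ⟩
      Σ n (λ j → basis o j - c)   ≡⟨ Σ-cong n (λ j → sym (M≡ o j)) ⟩
      Σ n (M o)                   ≡⟨ M-row o ⟩
      0ℚ                          ∎))

  PL-centering : Σ[ c ∈ ℚ ] N * c ≡ 1ℚ × (∀ i j → (P ⊗ L) i j ≡ basis i j - c)
  PL-centering = centering {M = P ⊗ L} PL-sym
    (λ i j → trans (sym (⊗-assoc L P L i j)) (LPL≡L i j))
    (λ i → trans (Σ-row-⊗ P L i) (Σ-zero n (λ k → trans (cong (P i k *_) (rowSum≡0 k)) (*-zeroʳ (P i k)))))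

  LP-centering : Σ[ c ∈ ℚ ] N * c ≡ 1ℚ × (∀ i j → (L ⊗ P) i j ≡ basis i j - c)
  LP-centering = centering {M = L ⊗ P} LP-sym
    (λ i j → trans (⊗-transpose symmetric LP-sym i j) (trans (LPL≡L j i) (symmetric j i)))
    (λ i → trans (Σ-cong n (LP-sym i)) (trans (Σ-col-⊗ L P i)
             (Σ-zero n (λ k → trans (cong (_* P k i) (colSum≡0 k)) (*-zeroˡ (P k i))))))

  c : ℚ
  c = proj₁ PL-centering

  Nc≡1 : N * c ≡ 1ℚ
  Nc≡1 = proj₁ (proj₂ PL-centering)

  PL≡ : ∀ i j → (P ⊗ L) i j ≡ basis i j - c
  PL≡ = proj₂ (proj₂ PL-centering)

  LP≡ : ∀ i j → (L ⊗ P) i j ≡ basis i j - c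
  LP≡ i j = trans (proj₂ (proj₂ LP-centering) i j)
    (cong (basis i j -_) (*-inverse-unique N (proj₁ (proj₂ LP-centering)) Nc≡1))

  Σ-centering≡0 : ∀ i → Σ n (λ j → basis i j - c) ≡ 0ℚ
  Σ-centering≡0 i = trans (Σ-centering c i) (trans (cong (1ℚ -_) Nc≡1) (+-inverseʳ 1ℚ))

  P-rowSum≡0 : ∀ i → Σ n (P i) ≡ 0ℚ
  P-rowSum≡0 i = begin
    Σ n (P i)                              ≡⟨ Σ-cong n (λ j → trans (sym (PLP≡P i j)) (⊗-assoc P L P i j)) ⟩
    Σ n ((P ⊗ (L ⊗ P)) i)                  ≡⟨ Σ-row-⊗ P (L ⊗ P) i ⟩
    Σ n (λ k → P i k * Σ n ((L ⊗ P) k))    ≡⟨ Σ-zero n (λ k → trans (cong (P i k *_) (trans (Σ-cong n (LP≡ k)) (Σ-centering≡0 k))) (*-zeroʳ (P i k))) ⟩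
    0ℚ                                     ∎

  P-colSum≡0 : ∀ j → Σ n (λ i → P i j) ≡ 0ℚ
  P-colSum≡0 j = begin
    Σ n (λ i → P i j)                              ≡⟨ Σ-cong n (λ i → sym (PLP≡P i j)) ⟩
    Σ n (λ i → (P ⊗ L ⊗ P) i j)                    ≡⟨ Σ-col-⊗ (P ⊗ L) P j ⟩
    Σ n (λ k → Σ n (λ i → (P ⊗ L) i k) * P k j)    ≡⟨ Σ-zero n (λ k → trans (cong (_* P k j) (PL-colSum k)) (*-zeroˡ (P k j))) ⟩
    0ℚ                                             ∎
    where
    PL-colSum : ∀ k → Σ n (λ i → (P ⊗ L) i k) ≡ 0ℚ
    PL-colSum k = trans (Σ-cong n (λ i → trans (PL≡ i k) (cong (_- c) (basis-sym i k)))) (Σ-centering≡0 k)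

  P-sym : IsSymmetric P
  P-sym i j = x∙y⁻¹≈ε⇒x≈y (P i j) (P j i) (kernel-sum≡0 x Lx≡0 c Nc≡1 Σx≡0 i)
    where
    x : Vector n
    x k = P k j - P j k

    Lx≡0 : ∀ i → (L ·ᵥ x) i ≡ 0ℚ
    Lx≡0 i = begin
      Σ n (λ k → L i k * (P k j - P j k))
        ≡⟨ Σ-cong n (λ k → solve 3 (λ l p p′ → l :* (p :- p′) := l :* p :- p′ :* l) refl (L i k) (P k j) (P j k)) ⟩
      Σ n (λ k → L i k * P k j - P j k * L i k)         ≡⟨ Σ-distrib-minus n _ _ ⟩
      (L ⊗ P) i j - Σ n (λ k → P j k * L i k)           ≡⟨ cong ((L ⊗ P) i j -_) (Σ-cong n (λ k → cong (P j k *_) (symmetric i k))) ⟩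
      (L ⊗ P) i j - (P ⊗ L) j i                         ≡⟨ cong₂ _-_ (LP≡ i j) (trans (PL≡ j i) (cong (_- c) (basis-sym j i))) ⟩
      (basis i j - c) - (basis i j - c)                 ≡⟨ +-inverseʳ (basis i j - c) ⟩
      0ℚ                                                ∎

    Σx≡0 : Σ n x ≡ 0ℚ
    Σx≡0 = trans (Σ-distrib-minus n _ _) (trans (cong₂ _-_ (P-colSum≡0 j) (P-rowSum≡0 j)) (+-inverseʳ 0ℚ))

  R : Matrix n
  R = resistance P

  d : Vector n
  d v = P v v

  T : ℚ
  T = Σ n d

  Ld : Vector n
  Ld = L ·ᵥ d

  D : ℚ
  D = dot d Ld

  γ₀ : ℚ
  γ₀ = (+ 1 / 4) * D + c * T

  R-expand : ∀ v w → R v w ≡ (d v + d w) - (P v w + P v w)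
  R-expand v w = trans (resistance-expand P v w) (cong (λ p → (d v + d w) - (P v w + p)) (P-sym w v))

  R-·ᵥ : ∀ (f : Vector n) v → (R ·ᵥ f) v ≡ (d v * Σ n f + dot d f) - ((P ·ᵥ f) v + (P ·ᵥ f) v)
  R-·ᵥ f v = begin
    Σ n (λ k → R v k * f k)
      ≡⟨ Σ-cong n (λ k → trans (cong (_* f k) (R-expand v k))
           (solve 4 (λ a b p x → ((a :+ b) :- (p :+ p)) :* x := (a :* x :+ b :* x) :- (p :* x :+ p :* x))
              refl (d v) (d k) (P v k) (f k))) ⟩
    Σ n (λ k → (d v * f k + d k * f k) - (P v k * f k + P v k * f k))
      ≡⟨ Σ-distrib-minus n _ _ ⟩
    Σ n (λ k → d v * f k + d k * f k) - Σ n (λ k → P v k * f k + P v k * f k)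
      ≡⟨ cong₂ _-_ (trans (Σ-distrib-+ n _ _) (cong (_+ dot d f) (sym (*-distribˡ-Σ n (d v) f))))
                   (Σ-distrib-+ n _ _) ⟩
    (d v * Σ n f + dot d f) - ((P ·ᵥ f) v + (P ·ᵥ f) v) ∎

  Σ-Ld : Σ n Ld ≡ 0ℚ
  Σ-Ld = trans (Σ-comm n n _) (Σ-zero n (λ j →
    trans (sym (*-distribʳ-Σ n (d j) (λ k → L k j))) (trans (cong (_* d j) (colSum≡0 j)) (*-zeroˡ (d j)))))

  P-Ld : ∀ v → (P ·ᵥ Ld) v ≡ d v - c * T
  P-Ld v = begin
    (P ·ᵥ Ld) v                                        ≡⟨ ·ᵥ-⊗ P L d v ⟩
    Σ n (λ j → (P ⊗ L) v j * d j)
      ≡⟨ Σ-cong n (λ j → trans (cong (_* d j) (PL≡ v j))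
           (solve 3 (λ b c x → (b :- c) :* x := b :* x :- c :* x) refl (basis v j) c (d j))) ⟩
    Σ n (λ j → basis v j * d j - c * d j)              ≡⟨ Σ-distrib-minus n _ _ ⟩
    Σ n (λ j → basis v j * d j) - Σ n (λ j → c * d j)  ≡⟨ cong₂ _-_ (Σ-basis n v d) (sym (*-distribˡ-Σ n c d)) ⟩
    d v - c * T                                        ∎

  R-affine : ∀ a b v → (R ·ᵥ (λ k → a * Ld k + b * c)) v ≡
             a * (D - (d v + d v) + (c * T + c * T)) + b * (d v + c * T)
  R-affine a b v = begin
    (R ·ᵥ f) v                                              ≡⟨ R-·ᵥ f v ⟩
    (d v * Σ n f + dot d f) - ((P ·ᵥ f) v + (P ·ᵥ f) v)     ≡⟨ cong₂ (λ s t → (d v * s + dot d f) - (t + t)) Σf Pf ⟩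
    (d v * b + dot d f) - (p + p)                           ≡⟨ cong (λ t → (d v * b + t) - (p + p)) df ⟩
    (d v * b + (a * D + (b * c) * T)) - (p + p)
      ≡⟨ solve 6 (λ a b c D T x → (x :* b :+ (a :* D :+ (b :* c) :* T)) :- (a :* (x :- c :* T) :+ a :* (x :- c :* T))
                                 := a :* (D :- (x :+ x) :+ (c :* T :+ c :* T)) :+ b :* (x :+ c :* T))
           refl a b c D T (d v) ⟩
    a * (D - (d v + d v) + (c * T + c * T)) + b * (d v + c * T) ∎
    where
    f : Vector n
    f k = a * Ld k + b * c

    p : ℚ
    p = a * (d v - c * T)

    Σf : Σ n f ≡ b
    Σf = begin
      Σ n f                             ≡⟨ Σ-linear n a b Ld (λ _ → c) ⟩
      a * Σ n Ld + b * Σ n (λ _ → c)    ≡⟨ cong₂ (λ s t → a * s + b * t) Σ-Ld (trans (Σ-const n c) Nc≡1) ⟩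
      a * 0ℚ + b * 1ℚ                   ≡⟨ solve 2 (λ a b → a :* con 0ℚ :+ b :* con 1ℚ := b) refl a b ⟩
      b                                 ∎

    df : dot d f ≡ a * D + (b * c) * T
    df = trans (Σ-cong n (λ k → solve 5 (λ a b c x y → x :* (a :* y :+ b :* c) := a :* (x :* y) :+ (b :* c) :* x) refl a b c (d k) (Ld k)))
               (Σ-linear n a (b * c) (λ k → d k * Ld k) d)

    Pf : (P ·ᵥ f) v ≡ p
    Pf = trans (Σ-cong n (λ k → solve 5 (λ a b c p y → p :* (a :* y :+ b :* c) := a :* (p :* y) :+ (b :* c) :* p) refl a b c (P v k) (Ld k)))
               (trans (Σ-linear n a (b * c) (λ k → P v k * Ld k) (P v))
               (trans (cong₂ (λ s t → a * s + (b * c) * t) (P-Ld v) (P-rowSum≡0 v))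
                      (solve 3 (λ p a b → p :+ a :* b :* con 0ℚ := p) refl p b c)))

  RL≡ : ∀ v k → (R ⊗ L) v k ≡ (Ld k + (c + c)) - (basis v k + basis v k)
  RL≡ v k = begin
    (R ⊗ L) v k                                                        ≡⟨ R-·ᵥ (λ j → L j k) v ⟩
    (d v * Σ n (λ j → L j k) + dot d (λ j → L j k)) - ((P ⊗ L) v k + (P ⊗ L) v k)
      ≡⟨ cong₂ (λ s t → (d v * s + t) - ((P ⊗ L) v k + (P ⊗ L) v k)) (colSum≡0 k) dL ⟩
    (d v * 0ℚ + Ld k) - ((P ⊗ L) v k + (P ⊗ L) v k)
      ≡⟨ cong (λ u → (d v * 0ℚ + Ld k) - (u + u)) (PL≡ v k) ⟩
    (d v * 0ℚ + Ld k) - ((basis v k - c) + (basis v k - c))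
      ≡⟨ solve 4 (λ x l b c → (x :* con 0ℚ :+ l) :- ((b :- c) :+ (b :- c)) := (l :+ (c :+ c)) :- (b :+ b)) refl (d v) (Ld k) (basis v k) c ⟩
    (Ld k + (c + c)) - (basis v k + basis v k)                         ∎
    where
    dL : dot d (λ j → L j k) ≡ Ld k
    dL = Σ-cong n (λ j → trans (*-comm (d j) (L j k)) (cong (_* d j) (symmetric j k)))

  RLR-diag : ∀ v → (R ⊗ L ⊗ R) v v ≡ (γ₀ + γ₀) + (γ₀ + γ₀)
  RLR-diag v = begin
    Σ n (λ k → (R ⊗ L) v k * R k v)
      ≡⟨ Σ-cong n (λ k → trans (cong₂ _*_ (RL≡ v k) (resistance-sym P k v))
           (solve 4 (λ l c b r → ((l :+ (c :+ c)) :- (b :+ b)) :* r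
                                 := r :* (con 1ℚ :* l :+ (con 1ℚ :+ con 1ℚ) :* c) :- (b :* r :+ b :* r))
              refl (Ld k) c (basis v k) (R v k))) ⟩
    Σ n (λ k → R v k * f k - (basis v k * R v k + basis v k * R v k))
      ≡⟨ trans (Σ-distrib-minus n _ _) (cong ((R ·ᵥ f) v -_) (Σ-distrib-+ n _ _)) ⟩
    (R ·ᵥ f) v - (Σ n (λ k → basis v k * R v k) + Σ n (λ k → basis v k * R v k))
      ≡⟨ cong₂ (λ s t → s - (t + t)) (R-affine 1ℚ (1ℚ + 1ℚ) v) (trans (Σ-basis n v (R v)) (resistance-diag P v)) ⟩
    (1ℚ * (D - (d v + d v) + (c * T + c * T)) + (1ℚ + 1ℚ) * (d v + c * T)) - (0ℚ + 0ℚ)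
      ≡⟨ solve 4 (λ D x c T → let γ = con (+ 1 / 4) :* D :+ c :* T in
                  (con 1ℚ :* (D :- (x :+ x) :+ (c :* T :+ c :* T)) :+ (con 1ℚ :+ con 1ℚ) :* (x :+ c :* T))
                    :- (con 0ℚ :+ con 0ℚ)
                  := (γ :+ γ) :+ (γ :+ γ))
           refl D (d v) c T ⟩
    (γ₀ + γ₀) + (γ₀ + γ₀) ∎
    where
    f : Vector n
    f k = 1ℚ * Ld k + (1ℚ + 1ℚ) * c

  L-R-diag : ∀ x → (L ·ᵥ R x) x ≡ (Ld x + (c + c)) - (1ℚ + 1ℚ)
  L-R-diag x = begin
    Σ n (λ w → L x w * R x w)
      ≡⟨ Σ-cong n (λ w → trans (*-comm (L x w) (R x w)) (cong (R x w *_) (symmetric x w))) ⟩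
    (R ⊗ L) x x                                 ≡⟨ RL≡ x x ⟩
    (Ld x + (c + c)) - (basis x x + basis x x)  ≡⟨ cong (λ b → (Ld x + (c + c)) - (χ b + χ b)) (eqᵇ-refl x) ⟩
    (Ld x + (c + c)) - (1ℚ + 1ℚ)                ∎

  μ : Vector n
  μ x = ½ * Ld x + c

  Σ-μ : Σ n μ ≡ 1ℚ
  Σ-μ = begin
    Σ n μ                              ≡⟨ Σ-cong n (λ k → cong (_+_ (½ * Ld k)) (sym (*-identityˡ c))) ⟩
    Σ n (λ k → ½ * Ld k + 1ℚ * c)      ≡⟨ Σ-linear n ½ 1ℚ Ld (λ _ → c) ⟩
    ½ * Σ n Ld + 1ℚ * Σ n (λ _ → c)    ≡⟨ cong₂ (λ s t → ½ * s + 1ℚ * t) Σ-Ld (trans (Σ-const n c) Nc≡1) ⟩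
    ½ * 0ℚ + 1ℚ * 1ℚ                   ≡⟨⟩
    1ℚ                                 ∎

  R-μ : ∀ v → (R ·ᵥ μ) v ≡ γ₀ + γ₀
  R-μ v = begin
    (R ·ᵥ μ) v                          ≡⟨ Σ-cong n (λ k → cong (λ t → R v k * (½ * Ld k + t)) (sym (*-identityˡ c))) ⟩
    (R ·ᵥ (λ k → ½ * Ld k + 1ℚ * c)) v  ≡⟨ R-affine ½ 1ℚ v ⟩
    ½ * (D - (d v + d v) + (c * T + c * T)) + 1ℚ * (d v + c * T)
      ≡⟨ solve 4 (λ D x c T → let γ = con (+ 1 / 4) :* D :+ c :* T in
                  con ½ :* (D :- (x :+ x) :+ (c :* T :+ c :* T)) :+ con 1ℚ :* (x :+ c :* T) := γ :+ γ)
           refl D (d v) c T ⟩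
    γ₀ + γ₀                             ∎

  dot-μ-constant : ∀ z → dot μ (λ _ → z) ≡ z
  dot-μ-constant z = begin
    Σ n (λ k → μ k * z)  ≡⟨ sym (*-distribʳ-Σ n z μ) ⟩
    Σ n μ * z            ≡⟨ cong (_* z) Σ-μ ⟩
    1ℚ * z               ≡⟨ *-identityˡ z ⟩
    z                    ∎

-- Graph Laplacians

χ-∨-disjoint : ∀ a b → a ∧ b ≡ false → χ (a ∨ b) ≡ (χ a - χ b) * (χ a - χ b)
χ-∨-disjoint true  true  ()
χ-∨-disjoint true  false _ = refl
χ-∨-disjoint false true  _ = refl
χ-∨-disjoint false false _ = refl

-- a, b say that v is the source, resp. target, of an edge, and a′, b′ the same for w ≠ v.
χ-joins : ∀ a b a′ b′ → a ∧ b ≡ false → a′ ∧ b′ ≡ false → a ∧ a′ ≡ false → b ∧ b′ ≡ false →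
          0ℚ - χ ((a ∧ b′) ∨ (a′ ∧ b)) ≡ (χ a - χ b) * (χ a′ - χ b′)
χ-joins true  true  _     _     ()  _  _  _
χ-joins true  false true  _     _   _  () _
χ-joins true  false false true  _   _  _  _ = refl
χ-joins true  false false false _   _  _  _ = refl
χ-joins false true  _     true  _   _  _  ()
χ-joins false true  true  false _   _  _  _ = refl
χ-joins false true  false false _   _  _  _ = refl
χ-joins false false true  true  _   () _  _
χ-joins false false true  false _   _  _  _ = refl
χ-joins false false false true  _   _  _  _ = refl
χ-joins false false false false _   _  _  _ = refl

-- a, b say that x is the source, resp. target, of an edge of weight r; u, w are the weights from x to them.
χ-∨-weight : ∀ a b {r u w : ℚ} → a ∧ b ≡ false →
             (a ≡ true → u ≡ 0ℚ × w ≡ r) → (b ≡ true → u ≡ r × w ≡ 0ℚ) →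
             χ (a ∨ b) * r ≡ 0ℚ - (χ a - χ b) * (u - w)
χ-∨-weight true true () _ _
χ-∨-weight true false {r} _ at _ with at refl
... | refl , refl = solve 1 (λ r → con 1ℚ :* r := con 0ℚ :- (con 1ℚ :- con 0ℚ) :* (con 0ℚ :- r)) refl r
χ-∨-weight false true {r} _ _ bt with bt refl
... | refl , refl = solve 1 (λ r → con 1ℚ :* r := con 0ℚ :- (con 0ℚ :- con 1ℚ) :* (r :- con 0ℚ)) refl r
χ-∨-weight false false {r} {u} {w} _ _ _ =
  solve 2 (λ r y → con 0ℚ :* r := con 0ℚ :- (con 0ℚ :- con 0ℚ) :* y) refl r (u - w)

module GraphLaplacian {n m} (G : Graph n m) (loopless : Loopless G) where

  L : Matrix n
  L = laplacian G

  s t : Fin m → Fin n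
  s = src G
  t = tgt G

  incidence : Fin m → Vector n
  incidence e i = basis (s e) i - basis (t e) i

  endpoints-disjoint : ∀ e x → eqᵇ (s e) x ∧ eqᵇ (t e) x ≡ false
  endpoints-disjoint e x = eqᵇ-disjoint x (loopless e)

  laplacian-incidence : ∀ v w → L v w ≡ Σ m (λ e → incidence e v * incidence e w)
  laplacian-incidence v w with v ≟ w
  ... | yes refl = begin
    degree G v  ≡⟨ Σ-cong m (λ e → χ-∨-disjoint (eqᵇ (s e) v) (eqᵇ (t e) v) (endpoints-disjoint e v)) ⟩
    Σ m (λ e → incidence e v * incidence e v) ∎
  ... | no v≢w = begin
    0ℚ - multiplicity               ≡⟨ cong (_- multiplicity) (sym (Σ-zero m (λ _ → refl))) ⟩
    Σ m (λ _ → 0ℚ) - multiplicity   ≡⟨ sym (Σ-distrib-minus m _ _) ⟩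
    Σ m (λ e → 0ℚ - χ (joins G e v w))
      ≡⟨ Σ-cong m (λ e → χ-joins (eqᵇ (s e) v) (eqᵇ (t e) v) (eqᵇ (s e) w) (eqᵇ (t e) w)
                                 (endpoints-disjoint e v) (endpoints-disjoint e w) (distinct (s e)) (distinct (t e))) ⟩
    Σ m (λ e → incidence e v * incidence e w) ∎
    where
    multiplicity : ℚ
    multiplicity = Σ m (λ e → χ (joins G e v w))

    distinct : ∀ x → eqᵇ x v ∧ eqᵇ x w ≡ false
    distinct x = trans (cong₂ _∧_ (eqᵇ-sym x v) (eqᵇ-sym x w)) (eqᵇ-disjoint x v≢w)

  laplacian-sym : IsSymmetric L
  laplacian-sym v w = begin
    L v w                                      ≡⟨ laplacian-incidence v w ⟩
    Σ m (λ e → incidence e v * incidence e w)  ≡⟨ Σ-cong m (λ e → *-comm (incidence e v) _) ⟩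
    Σ m (λ e → incidence e w * incidence e v)  ≡⟨ sym (laplacian-incidence w v) ⟩
    L w v                                      ∎

  laplacian-·ᵥ : ∀ x v → (L ·ᵥ x) v ≡ Σ m (λ e → incidence e v * (x (s e) - x (t e)))
  laplacian-·ᵥ x v = begin
    Σ n (λ w → L v w * x w)
      ≡⟨ Σ-cong n (λ w → trans (cong (_* x w) (laplacian-incidence v w)) (*-distribʳ-Σ m (x w) _)) ⟩
    Σ n (λ w → Σ m (λ e → incidence e v * incidence e w * x w))
      ≡⟨ Σ-comm n m _ ⟩
    Σ m (λ e → Σ n (λ w → incidence e v * incidence e w * x w))
      ≡⟨ Σ-cong m (λ e → trans (Σ-cong n (λ w → *-assoc (incidence e v) _ _)) (sym (*-distribˡ-Σ n (incidence e v) _))) ⟩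
    Σ m (λ e → incidence e v * Σ n (λ w → incidence e w * x w))
      ≡⟨ Σ-cong m (λ e → cong (incidence e v *_) (Σ-basis-diff n (s e) (t e) x)) ⟩
    Σ m (λ e → incidence e v * (x (s e) - x (t e))) ∎

  laplacian-rowSum≡0 : ∀ v → Σ n (L v) ≡ 0ℚ
  laplacian-rowSum≡0 v = begin
    Σ n (L v)                                  ≡⟨ Σ-cong n (λ w → sym (*-identityʳ (L v w))) ⟩
    (L ·ᵥ (λ _ → 1ℚ)) v                        ≡⟨ laplacian-·ᵥ (λ _ → 1ℚ) v ⟩
    Σ m (λ e → incidence e v * (1ℚ - 1ℚ))      ≡⟨ Σ-zero m (λ e → *-zeroʳ (incidence e v)) ⟩
    0ℚ                                         ∎

  laplacian-quadratic : ∀ x → dot x (L ·ᵥ x) ≡ Σ m (λ e → (x (s e) - x (t e)) * (x (s e) - x (t e)))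
  laplacian-quadratic x = begin
    Σ n (λ v → x v * (L ·ᵥ x) v)
      ≡⟨ Σ-cong n (λ v → trans (cong (x v *_) (laplacian-·ᵥ x v)) (*-distribˡ-Σ m (x v) _)) ⟩
    Σ n (λ v → Σ m (λ e → x v * (incidence e v * y e)))
      ≡⟨ Σ-comm n m _ ⟩
    Σ m (λ e → Σ n (λ v → x v * (incidence e v * y e)))
      ≡⟨ Σ-cong m (λ e → trans (Σ-cong n (λ v → solve 3 (λ a b c → a :* (b :* c) := b :* a :* c) refl (x v) (incidence e v) (y e)))
                               (sym (*-distribʳ-Σ n (y e) _))) ⟩
    Σ m (λ e → Σ n (λ v → incidence e v * x v) * y e)
      ≡⟨ Σ-cong m (λ e → cong (_* y e) (Σ-basis-diff n (s e) (t e) x)) ⟩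
    Σ m (λ e → y e * y e) ∎
    where
    y : Fin m → ℚ
    y e = x (s e) - x (t e)

  laplacian-kernel : Connected G → ∀ x → (∀ i → (L ·ᵥ x) i ≡ 0ℚ) → ∀ i j → x i ≡ x j
  laplacian-kernel connected x Lx≡0 i j = along (connected i j)
    where
    edge : ∀ e → x (s e) ≡ x (t e)
    edge e = x∙y⁻¹≈ε⇒x≈y _ _ (Σ-squares≡0⇒≡0 m (λ e → x (s e) - x (t e))
      (trans (sym (laplacian-quadratic x)) (Σ-zero n (λ v → trans (cong (x v *_) (Lx≡0 v)) (*-zeroʳ (x v))))) e)

    along : ∀ {i j} → Reach G i j → x i ≡ x j
    along here      = refl
    along (fwd e r) = trans (edge e) (along r)
    along (bwd e r) = trans (sym (edge e)) (along r)

  isConnectedLaplacian : Connected G → IsConnectedLaplacian L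
  isConnectedLaplacian connected = record
    { symmetric       = laplacian-sym
    ; rowSum≡0        = laplacian-rowSum≡0
    ; kernel-constant = laplacian-kernel connected
    }

  curvature-laplacian : ∀ P x → curvature G P x ≡ 1ℚ - ½ * (0ℚ - (L ·ᵥ resistance P x) x)
  curvature-laplacian P x = cong (λ z → 1ℚ - ½ * z) (begin
    Σ m (λ e → χ (incident G e x) * R (s e) (t e))
      ≡⟨ Σ-cong m (λ e → χ-∨-weight (eqᵇ (s e) x) (eqᵇ (t e) x) (endpoints-disjoint e x) (at-source e) (at-target e)) ⟩
    Σ m (λ e → 0ℚ - incidence e x * (R x (s e) - R x (t e)))
      ≡⟨ Σ-distrib-minus m _ _ ⟩
    Σ m (λ _ → 0ℚ) - Σ m (λ e → incidence e x * (R x (s e) - R x (t e)))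
      ≡⟨ cong₂ _-_ (Σ-zero m (λ _ → refl)) (sym (laplacian-·ᵥ (R x) x)) ⟩
    0ℚ - (L ·ᵥ R x) x ∎)
    where
    R : Matrix n
    R = resistance P

    at-source : ∀ e → eqᵇ (s e) x ≡ true → R x (s e) ≡ 0ℚ × R x (t e) ≡ R (s e) (t e)
    at-source e s≡x rewrite eqᵇ⇒≡ s≡x = resistance-diag P x , refl

    at-target : ∀ e → eqᵇ (t e) x ≡ true → R x (s e) ≡ R (s e) (t e) × R x (t e) ≡ 0ℚ
    at-target e t≡x rewrite eqᵇ⇒≡ t≡x = resistance-sym P x (s e) , resistance-diag P x

-- Curvature and the resistance matrix of a connected graph

module ResistanceCurvature {n m} (G : Graph n m) (loopless : Loopless G) (connected : Connected G)
                           {P : Matrix n} (pinv : IsPseudoInverse (laplacian G) P) (q : Fin n) where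
  open GraphLaplacian G loopless public
  open ConnectedLaplacian (isConnectedLaplacian connected) pinv q public

  curvature≡μ : ∀ x → curvature G P x ≡ μ x
  curvature≡μ x = begin
    curvature G P x                                           ≡⟨ curvature-laplacian P x ⟩
    1ℚ - ½ * (0ℚ - (L ·ᵥ R x) x)                             ≡⟨ cong (λ y → 1ℚ - ½ * (0ℚ - y)) (L-R-diag x) ⟩
    1ℚ - ½ * (0ℚ - ((Ld x + (c + c)) - (1ℚ + 1ℚ)))
      ≡⟨ solve 2 (λ l c → con 1ℚ :- con ½ :* (con 0ℚ :- ((l :+ (c :+ c)) :- (con 1ℚ :+ con 1ℚ))) := con ½ :* l :+ c) refl (Ld x) c ⟩
    μ x                                                       ∎

  R-curvature : ∀ v → (R ·ᵥ curvature G P) v ≡ γ₀ + γ₀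
  R-curvature v = trans (Σ-cong n (λ k → cong (R v k *_) (curvature≡μ k))) (R-μ v)

  curvature-R-curvature : dot (curvature G P) (R ·ᵥ curvature G P) ≡ γ₀ + γ₀
  curvature-R-curvature =
    trans (Σ-cong n (λ k → cong₂ _*_ (curvature≡μ k) (R-curvature k))) (dot-μ-constant (γ₀ + γ₀))

  γ≡γ₀ : γ G P q ≡ γ₀
  γ≡γ₀ = begin
    γ G P q                                             ≡⟨ cong ((+ 1 / 4) *_) (sym (laplacian-quadratic (λ i → R i q))) ⟩
    (+ 1 / 4) * dot (λ i → R i q) (L ·ᵥ (λ i → R i q))  ≡⟨ cong ((+ 1 / 4) *_) (dot-column (resistance-sym P) L q) ⟩
    (+ 1 / 4) * (R ⊗ L ⊗ R) q q                         ≡⟨ cong ((+ 1 / 4) *_) (RLR-diag q) ⟩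
    (+ 1 / 4) * ((γ₀ + γ₀) + (γ₀ + γ₀))                 ≡⟨ ¼-quadruple γ₀ ⟩
    γ₀                                                  ∎

proposition5p3 : (n m : ℕ) (G : Graph n m) → Loopless G → Connected G →
    (P : Matrix n) → IsPseudoInverse (laplacian G) P →
    (q : Fin n) →
      ((v : Fin n) → (+ 1 / 4) * (resistance P ⊗ laplacian G ⊗ resistance P) v v ≡ γ G P q)
      × (γ G P q ≡ ½ * dot (curvature G P) (resistance P ·ᵥ curvature G P))
      × ((v : Fin n) → ½ * (resistance P ·ᵥ curvature G P) v ≡ γ G P q)
proposition5p3 n m G loopless connected P pinv q = RLR≡γ , γ≡μRμ , Rμ≡γ
  where
  open ResistanceCurvature G loopless connected pinv q

  RLR≡γ : ∀ v → (+ 1 / 4) * (R ⊗ L ⊗ R) v v ≡ γ G P q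
  RLR≡γ v = begin
    (+ 1 / 4) * (R ⊗ L ⊗ R) v v           ≡⟨ cong ((+ 1 / 4) *_) (RLR-diag v) ⟩
    (+ 1 / 4) * ((γ₀ + γ₀) + (γ₀ + γ₀))   ≡⟨ ¼-quadruple γ₀ ⟩
    γ₀                                    ≡⟨ sym γ≡γ₀ ⟩
    γ G P q                               ∎

  γ≡μRμ : γ G P q ≡ ½ * dot (curvature G P) (R ·ᵥ curvature G P)
  γ≡μRμ = begin
    γ G P q                                         ≡⟨ γ≡γ₀ ⟩
    γ₀                                              ≡⟨ sym (½-double γ₀) ⟩
    ½ * (γ₀ + γ₀)                                   ≡⟨ cong (½ *_) (sym curvature-R-curvature) ⟩
    ½ * dot (curvature G P) (R ·ᵥ curvature G P)    ∎

  Rμ≡γ : ∀ v → ½ * (R ·ᵥ curvature G P) v ≡ γ G P q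
  Rμ≡γ v = begin
    ½ * (R ·ᵥ curvature G P) v   ≡⟨ cong (½ *_) (R-curvature v) ⟩
    ½ * (γ₀ + γ₀)                ≡⟨ ½-double γ₀ ⟩
    γ₀                           ≡⟨ sym γ≡γ₀ ⟩
    γ G P q                      ∎
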